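{- Let $G=(V,E)$ be a graph of neighborhood diversity $w$ with a vertex partition $V=W_1\,\dot\cup\,\cdots\,\dot\cup\, W_w$ into true twin classes. Let $V_1\,\dot\cup\,\cdots\,\dot\cup\, V_k$ be a $k$-Grundy coloring of $G$, and for each $i\in[k]$ let $I_i$ be the set of indices $j\in[w]$ such that $V_i\cap W_j\neq\emptyset$. If $I_i=I_{i'}$ for some $i'\ge i+2$, then the partition $V'_1\,\dot\cup\,\cdots\,\dot\cup\, V'_k$ defined by $V'_\ell=V_{i'}$ if $\ell=i+1$, $V'_\ell=V_{\ell-1}$ if $i+1<\ell\le i'$, and $V'_\ell=V_\ell$ otherwise, is also a $k$-Grundy coloring of $G$.
   Context: A $k$-Grundy coloring of a graph $(V,E)$ is a partition of $V$ into $k$ non-empty independent sets $V_1,\ldots,V_k$ (in this order) such that for each $i\in[k-1]$ every vertex of $\bigcup_{j>i}V_j$ has a neighbor in $V_i$. Two vertices $u,v$ are twins if $N(u)\setminus\{v\}=N(v)\setminus\{u\}$, true twins if moreover adjacent. A twin class is a maximal set of pairwise twins; a true twin class is a twin class that is a clique (possibly a singleton). $G$ has neighborhood diversity $w$ if $V$ can be partitioned into at most $w$ twin classes. -}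

module Defs where

open import Data.Nat using (ℕ; suc; _<_; _≤_; _+_)
open import Data.Nat.Properties using (_≟_; _<?_; _≤?_)
open import Data.Fin using (Fin; toℕ; pred)
open import Data.Product using (Σ; ∃; ∃-syntax; _×_; _,_)
open import Relation.Binary.PropositionalEquality using (_≡_; _≢_)
open import Relation.Nullary using (¬_; yes; no)
open import Function.Bundles using (_⇔_)

record Graph (n : ℕ) : Set₁ where
  field
    E     : Fin n → Fin n → Set
    sym   : ∀ {u v} → E u v → E v u
    irrefl : ∀ {u} → ¬ E u u

VSet : ℕ → Set₁
VSet n = Fin n → Set

module _ {n : ℕ} (G : Graph n) where
  open Graph G

  Twins : Fin n → Fin n → Set
  Twins u v = ∀ x → ((E u x × x ≢ v) ⇔ (E v x × x ≢ u))

  IsTwinClass : VSet n → Set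
  IsTwinClass S =
    (∀ u v → S u → S v → u ≢ v → Twins u v) ×
    (∀ v → ¬ S v → ∃[ u ] (S u × ¬ Twins u v))

  IsClique : VSet n → Set
  IsClique S = ∀ u v → S u → S v → u ≢ v → E u v

  IsTrueTwinClass : VSet n → Set
  IsTrueTwinClass S = IsTwinClass S × IsClique S

  IsIndependent : VSet n → Set
  IsIndependent S = ∀ u v → S u → S v → ¬ E u v

  IsPartition : ∀ {k} → (Fin k → VSet n) → Set
  IsPartition P =
    (∀ v → ∃[ ℓ ] P ℓ v) × (∀ v ℓ ℓ' → P ℓ v → P ℓ' v → ℓ ≡ ℓ')

  -- k-Grundy coloring V_1,...,V_k (indices 0..k-1 here)
  IsGrundyColoring : (k : ℕ) → (Fin k → VSet n) → Set
  IsGrundyColoring k P =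
    IsPartition P ×
    (∀ ℓ → ∃[ v ] P ℓ v) ×
    (∀ ℓ → IsIndependent (P ℓ)) ×
    (∀ ℓ m v → toℕ ℓ < toℕ m → P m v → ∃[ u ] (E v u × P ℓ u))

  IsTrueTwinPartition : (w : ℕ) → (Fin w → VSet n) → Set
  IsTrueTwinPartition w W = IsPartition W × (∀ j → IsTrueTwinClass (W j))

module _ {n k w : ℕ} where
  Index : (Fin k → VSet n) → (Fin w → VSet n) → Fin k → Fin w → Set
  Index P W i j = ∃[ v ] (P i v × W j v)

src : ∀ {k} → Fin k → Fin k → Fin k → Fin k
src i i' ℓ with toℕ ℓ ≟ suc (toℕ i)
... | yes _ = i'
... | no _ with suc (toℕ i) <? toℕ ℓ | toℕ ℓ ≤? toℕ i'
...   | yes _ | yes _ = pred ℓ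
...   | _     | _     = ℓ

reorder : ∀ {n k} → (Fin k → VSet n) → Fin k → Fin k → Fin k → VSet n
reorder P i i' ℓ = P (src i i' ℓ)

module Submission where

-- The proof has an arithmetic half and a graph-theoretic half.
--  * Arithmetic: a case view 'Position' of src shows that src is
--    injective (hence a permutation, since an injective endomap of Fin k
--    is surjective) and preserves the order of indices, with the single
--    exception that V_{i'} now precedes the classes strictly between V_i
--    and V_{i'}.
--  * Graphs: reindexing a Grundy colouring along a permutation yields a
--    Grundy colouring provided every later class still sees every earlier
--    one.  For the exceptional pairs this holds because a vertex between
--    V_i and V_{i'} has a neighbour u in V_i, and V_{i'} contains a twin of
--    u (same twin classes are met), which is then a neighbour as well.

open import Defs
open import Data.Nat using (ℕ; suc; _≤_; _<_; z≤n; s≤s; s≤s⁻¹; s<s⁻¹)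
open import Data.Nat.Properties
  using (_≟_; _<?_; _≤?_; <-cmp; <⇒≱; <-irrefl; <-trans; <-asym; ≤-trans; <-≤-trans; ≤-<-trans; n≤1+n; n<1+n; 1+n≰n; ≰⇒>; ≮⇒≥; ≤∧≢⇒<)
open import Data.Fin using (Fin; toℕ; pred; punchOut)
open import Data.Fin.Properties using (toℕ-injective; toℕ-inject₁; any?; injective⇒≤; punchOut-injective)
import Data.Fin as Fin
open import Data.Product using (∃-syntax; _×_; _,_; proj₁)
open import Data.Sum using (_⊎_; inj₁; inj₂)
open import Function.Definitions using (Injective)
open import Function.Bundles using (_⇔_; Equivalence)
open import Relation.Binary.Definitions using (tri<; tri≈; tri>)
open import Relation.Nullary using (¬_; yes; no; contradiction)
open import Relation.Binary.PropositionalEquality using (_≡_; _≢_; refl; sym; trans; cong)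

-- An injective map from a finite set to itself is surjective: if t were
-- missed, punching t out would inject Fin (suc n) into Fin n.
injective⇒surjective : ∀ {n} (f : Fin n → Fin n) → Injective _≡_ _≡_ f → ∀ t → ∃[ ℓ ] f ℓ ≡ t
injective⇒surjective {suc n} f f-inj t with any? (λ ℓ → f ℓ Fin.≟ t)
... | yes hit = hit
... | no miss = contradiction (injective⇒≤ punched-injective) 1+n≰n
  where
  avoids : ∀ ℓ → t ≢ f ℓ
  avoids ℓ e = miss (ℓ , sym e)
  punched-injective : Injective _≡_ _≡_ (λ ℓ → punchOut (avoids ℓ))
  punched-injective e = f-inj (punchOut-injective (avoids _) (avoids _) e)

suc-toℕ-pred : ∀ {k} (ℓ : Fin k) → 0 < toℕ ℓ → suc (toℕ (pred ℓ)) ≡ toℕ ℓ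
suc-toℕ-pred (Fin.suc j) _ = cong suc (toℕ-inject₁ j)

data Position (a b x s : ℕ) : Set where
  gap     : x ≡ suc a → s ≡ b → Position a b x s
  shifted : suc a < x → x ≤ b → suc s ≡ x → Position a b x s
  fixed   : x ≤ a ⊎ b < x → s ≡ x → Position a b x s

position : ∀ {k} (i i' ℓ : Fin k) → Position (toℕ i) (toℕ i') (toℕ ℓ) (toℕ (src i i' ℓ))
position i i' ℓ with toℕ ℓ ≟ suc (toℕ i)
... | yes at-gap = gap at-gap refl
... | no off-gap with suc (toℕ i) <? toℕ ℓ | toℕ ℓ ≤? toℕ i'
...   | yes above | yes below = shifted above below (suc-toℕ-pred ℓ (≤-<-trans z≤n above))
...   | yes _ | no not-below = fixed (inj₂ (≰⇒> not-below)) refl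
...   | no not-above | _ = fixed (inj₁ (s≤s⁻¹ (≤∧≢⇒< (≮⇒≥ not-above) off-gap))) refl

ShiftedOrder : (a b s t : ℕ) → Set
ShiftedOrder a b s t = s < t ⊎ (s ≡ b × a < t × t < b)

position-order : ∀ {a b x y s t} → suc (suc a) ≤ b → x < y
  → Position a b x s → Position a b y t → ShiftedOrder a b s t
position-order a+2≤b x<y (gap refl refl) (gap refl refl) = contradiction x<y (<-irrefl refl)
position-order a+2≤b x<y (gap refl refl) (shifted a<t t<b refl) = inj₂ (refl , s<s⁻¹ a<t , t<b)
position-order a+2≤b x<y (gap refl refl) (fixed (inj₁ y≤a) refl) = contradiction y≤a (<⇒≱ (<-trans (n<1+n _) x<y))
position-order a+2≤b x<y (gap refl refl) (fixed (inj₂ b<y) refl) = inj₁ b<y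
position-order a+2≤b x<y (shifted a<s _ refl) (gap refl refl) = contradiction x<y (<-asym a<s)
position-order a+2≤b x<y (shifted _ _ refl) (shifted _ _ refl) = inj₁ (s<s⁻¹ x<y)
position-order a+2≤b x<y (shifted a<s _ refl) (fixed (inj₁ y≤a) refl) = contradiction (≤-trans y≤a (n≤1+n _)) (<⇒≱ (<-trans a<s x<y))
position-order a+2≤b x<y (shifted _ s<b refl) (fixed (inj₂ b<y) refl) = inj₁ (<-trans (<-≤-trans (n<1+n _) s<b) b<y)
position-order a+2≤b x<y (fixed (inj₁ x≤a) refl) (gap refl refl) = inj₁ (≤-trans (s≤s x≤a) (≤-trans (n≤1+n _) a+2≤b))
position-order a+2≤b x<y (fixed (inj₁ x≤a) refl) (shifted a<t _ refl) = inj₁ (≤-<-trans x≤a (s<s⁻¹ a<t))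
position-order a+2≤b x<y (fixed _ refl) (fixed _ refl) = inj₁ x<y
position-order a+2≤b x<y (fixed (inj₂ b<x) refl) (gap refl refl) = contradiction (≤-trans (n≤1+n _) a+2≤b) (<⇒≱ (<-trans b<x x<y))
position-order a+2≤b x<y (fixed (inj₂ b<x) refl) (shifted _ t<b refl) = contradiction t<b (<⇒≱ (<-trans b<x x<y))

position-distinct : ∀ {a b x y s t} → suc (suc a) ≤ b → x < y
  → Position a b x s → Position a b y t → s ≢ t
position-distinct a+2≤b x<y ps pt s≡t with position-order a+2≤b x<y ps pt
... | inj₁ s<t = <-irrefl s≡t s<t
... | inj₂ (s≡b , _ , t<b) = <-irrefl (trans (sym s≡t) s≡b) t<b

module _ {k : ℕ} (i i' : Fin k) (i+2≤i' : suc (suc (toℕ i)) ≤ toℕ i') where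

  src-injective : Injective _≡_ _≡_ (src i i')
  src-injective {ℓ} {m} e with <-cmp (toℕ ℓ) (toℕ m)
  ... | tri≈ _ ℓ≡m _ = toℕ-injective ℓ≡m
  ... | tri< ℓ<m _ _ = contradiction (cong toℕ e) (position-distinct i+2≤i' ℓ<m (position i i' ℓ) (position i i' m))
  ... | tri> _ _ m<ℓ = contradiction (cong toℕ (sym e)) (position-distinct i+2≤i' m<ℓ (position i i' m) (position i i' ℓ))

  src-order : ∀ ℓ m → toℕ ℓ < toℕ m
    → toℕ (src i i' ℓ) < toℕ (src i i' m)
      ⊎ (src i i' ℓ ≡ i' × toℕ i < toℕ (src i i' m) × toℕ (src i i' m) < toℕ i')
  src-order ℓ m ℓ<m with position-order i+2≤i' ℓ<m (position i i' ℓ) (position i i' m)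
  ... | inj₁ ordered = inj₁ ordered
  ... | inj₂ (at-i' , between) = inj₂ (toℕ-injective at-i' , between)

module _ {n : ℕ} (G : Graph n) where
  open Graph G using (E)

  reindex-grundy : ∀ {k} (P : Fin k → VSet n) (σ : Fin k → Fin k)
    → IsGrundyColoring G k P
    → Injective _≡_ _≡_ σ
    → (∀ ℓ m v → toℕ ℓ < toℕ m → P (σ m) v → ∃[ u ] (E v u × P (σ ℓ) u))
    → IsGrundyColoring G k (λ ℓ → P (σ ℓ))
  reindex-grundy P σ ((covers , unique) , nonempty , independent , _) σ-inj dominates =
    (covers′ , λ v ℓ ℓ' p q → σ-inj (unique v _ _ p q))
    , (λ ℓ → nonempty (σ ℓ)) , (λ ℓ → independent (σ ℓ)) , dominates
    where
    covers′ : ∀ v → ∃[ ℓ ] P (σ ℓ) v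
    covers′ v with covers v
    ... | c , v∈c with injective⇒surjective σ σ-inj c
    ...   | ℓ , refl = ℓ , v∈c

  twin-neighbour : ∀ {S u u' v} → IsTwinClass G S → S u → S u' → u ≢ u'
    → E v u → v ≢ u' → E v u'
  twin-neighbour (twins , _) u∈S u'∈S u≢u' v~u v≢u' =
    Graph.sym G (proj₁ (Equivalence.to (twins _ _ u∈S u'∈S u≢u' _) (Graph.sym G v~u , v≢u')))

  neighbour-in-covering-class : ∀ {w k} (W : Fin w → VSet n) (P : Fin k → VSet n)
    → (∀ v → ∃[ j ] W j v) → (∀ j → IsTwinClass G (W j))
    → (∀ v ℓ ℓ' → P ℓ v → P ℓ' v → ℓ ≡ ℓ')
    → ∀ {a b} → a ≢ b → (∀ j → Index P W a j → Index P W b j)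
    → ∀ {u v} → P a u → E v u → ¬ P b v → ∃[ u' ] (E v u' × P b u')
  neighbour-in-covering-class W P covers twin-classes unique a≢b a⊆b {u} {v} u∈a v~u v∉b
    with covers u
  ... | j , u∈j with a⊆b j (u , u∈a , u∈j)
  ...   | u' , u'∈b , u'∈j = u' , twin-neighbour (twin-classes j) u∈j u'∈j u≢u' v~u v≢u' , u'∈b
    where
    u≢u' : u ≢ u'
    u≢u' refl = a≢b (unique u _ _ u∈a u'∈b)
    v≢u' : v ≢ u'
    v≢u' refl = v∉b u'∈b

lemma6p2 : {n w k : ℕ} (G : Graph n) (W : Fin w → VSet n) (P : Fin k → VSet n)
    → IsTrueTwinPartition G w W
    → IsGrundyColoring G k P
    → (i i' : Fin k)
    → suc (suc (toℕ i)) ≤ toℕ i'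
    → (∀ j → Index P W i j ⇔ Index P W i' j)
    → IsGrundyColoring G k (reorder P i i')
lemma6p2 G W P ((covers , _) , true-twin-classes) grundy@((_ , unique) , _ , _ , dominated) i i' i+2≤i' same-index =
  reindex-grundy G P (src i i') grundy (src-injective i i' i+2≤i') dominates
  where
  open Graph G using (E)
  i≢i' : i ≢ i'
  i≢i' refl = <-irrefl refl (≤-trans (n≤1+n _) i+2≤i')
  -- A class that moved behind V_{i'} sits strictly between V_i and V_{i'}:
  -- its vertices see V_i, hence by the twin structure also V_{i'}.
  dominates : ∀ ℓ m v → toℕ ℓ < toℕ m → P (src i i' m) v → ∃[ u ] (E v u × P (src i i' ℓ) u)
  dominates ℓ m v ℓ<m v∈m with src-order i i' i+2≤i' ℓ m ℓ<m
  ... | inj₁ ordered = dominated _ _ v ordered v∈m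
  ... | inj₂ (ℓ↦i' , i<m , m<i') rewrite ℓ↦i' with dominated i _ v i<m v∈m
  ...   | u , v~u , u∈i = neighbour-in-covering-class G W P covers (λ j → proj₁ (true-twin-classes j))
          unique i≢i' (λ j → Equivalence.to (same-index j)) u∈i v~u v∉i'
    where
    v∉i' : ¬ P i' v
    v∉i' v∈i' = <-irrefl (cong toℕ (unique v _ _ v∈m v∈i')) m<i'
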